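{- There is a universal constant $C$ such that the following holds. Let $0<p\le1/2$, $n$ a positive integer with $pn$ an integer, and let $f\colon\binom{[n]}{pn}\to\mathbb{Z}$ be of degree at most $k$. Then either $f\equiv0$ or $\Pr_x[f(x)\ne0]\ge p^{Ck}$, where $x$ is uniform on $\binom{[n]}{pn}$.
   Context: $\binom{[n]}{pn}=\{x\in\{0,1\}^n:\sum_ix_i=pn\}$. A function on this slice has degree at most $k$ if it is a (real) linear combination of the functions $\mathrm{AND}_T(x)=\prod_{i\in T}x_i$ with $|T|\le k$.
   Formalization: The linear combinations of the functions $\mathrm{AND}_T$ that define degree at most k have rational coefficients instead of real ones. -}

module Defs where

open import Data.Nat as ℕ using (ℕ; zero; suc)
open import Data.Bool using (Bool; true; false)
open import Data.Vec using (Vec; []; _∷_)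
open import Data.List using (List; []; _∷_; map; _++_; filter; foldr; length)
open import Data.Integer as ℤ using (ℤ; +_)
open import Data.Rational as ℚ using (ℚ; 0ℚ; 1ℚ; _+_; _*_; _/_)
open import Relation.Nullary using (¬?)
open import Relation.Binary.PropositionalEquality using (_≡_)
open import Data.Product using (Σ; _×_)

-- Points of {0,1}^n are Boolean vectors (true = 1). Index sets T ⊆ [n]
-- are also represented by their indicator vectors.

cube : (n : ℕ) → List (Vec Bool n)
cube zero = [] ∷ []
cube (suc n) = map (false ∷_) (cube n) ++ map (true ∷_) (cube n)

weight : ∀ {n} → Vec Bool n → ℕ
weight [] = 0
weight (false ∷ x) = weight x
weight (true ∷ x) = suc (weight x)

slice : (n m : ℕ) → List (Vec Bool n)
slice n m = filter (λ x → weight x ℕ.≟ m) (cube n)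

AND : ∀ {n} → Vec Bool n → Vec Bool n → ℚ
AND [] [] = 1ℚ
AND (false ∷ T) (_ ∷ x) = AND T x
AND (true ∷ T) (false ∷ x) = 0ℚ
AND (true ∷ T) (true ∷ x) = AND T x

sumℚ : List ℚ → ℚ
sumℚ = foldr _+_ 0ℚ

_^ℚ_ : ℚ → ℕ → ℚ
q ^ℚ zero = 1ℚ
q ^ℚ suc e = q * (q ^ℚ e)

ℤ→ℚ : ℤ → ℚ
ℤ→ℚ z = z / 1

-- f : ([n] choose m) → ℤ (values off the slice are irrelevant) has degree ≤ k:
-- f agrees on the slice with a linear combination Σ_T c_T AND_T with c_T = 0 when |T| > k.
DegreeAtMost : (n m k : ℕ) → (Vec Bool n → ℤ) → Set
DegreeAtMost n m k f =
  Σ (Vec Bool n → ℚ) λ c →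
    (∀ T → k ℕ.< weight T → c T ≡ 0ℚ) ×
    (∀ x → weight x ≡ m → ℤ→ℚ (f x) ≡ sumℚ (map (λ T → c T * AND T x) (cube n)))

VanishesOnSlice : (n m : ℕ) → (Vec Bool n → ℤ) → Set
VanishesOnSlice n m f = ∀ x → weight x ≡ m → f x ≡ + 0

nonzeroCount : (n m : ℕ) → (Vec Bool n → ℤ) → ℕ
nonzeroCount n m f = length (filter (λ x → ¬? (f x ℤ.≟ + 0)) (slice n m))

-- "Pr_x[f(x) ≠ 0] ≥ q" for x uniform on the slice, written without division:
-- #{x ∈ slice : f x ≠ 0} ≥ q · |slice|.
ProbNonzeroAtLeast : (n m : ℕ) → (Vec Bool n → ℤ) → ℚ → Set
ProbNonzeroAtLeast n m f q = q * ℤ→ℚ (+ length (slice n m)) ℚ.≤ ℤ→ℚ (+ nonzeroCount n m f)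

{-# OPTIONS --safe #-}

-- For a pair (a , b) of coordinates let Δ_(a,b) g x = g(x with a ↦ 1, b ↦ 0) − g(x with a ↦ 0, b ↦ 1).
-- If f has degree at most k on the slice, every (k + 1)-fold difference along disjoint pairs vanishes on
-- the slice: by pigeonhole each monomial AND_T with |T| ≤ k ignores both coordinates of one of the pairs.
-- This property alone forces a nonzero f to have at least C(n − 2k, m − k) nonzeros, by induction on n
-- splitting on the first coordinate: if both halves are nonzero use Pascal's rule; if one half vanishes,
-- pairing the first coordinate with a suitable free coordinate shows that the other half has vanishing
-- differences of order k. Finally m^{8k} C(n, m) ≤ n^{8k} C(n − 2k, m − k) for 2m ≤ n, by factorial
-- estimates resting on (1 + 1/N)^j ≤ 8 for j ≤ N; so C = 8 works.

module Submission where

open import Defs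
open import Algebra.Bundles using (CommutativeMonoid)
open import Data.Bool using (Bool; true; false; not)
open import Data.Bool.Properties using (not-¬)
open import Data.Empty using (⊥-elim)
open import Data.Fin using (Fin; zero; suc)
open import Data.Fin.Properties using (suc-injective) renaming (_≟_ to _≟ᶠ_)
open import Data.Integer as ℤ using (ℤ; +_)
open import Data.Integer.GCD using (gcd)
import Data.Integer.Properties as ℤP
open import Data.List using (List; []; _∷_; length; map; _++_; filter)
open import Data.List.Membership.Propositional using (_∈_; lose)
open import Data.List.Membership.Propositional.Properties
  using (∈-++⁺ˡ; ∈-++⁺ʳ; ∈-map⁺; ∈-filter⁺; ∈-filter⁻)
open import Data.List.Properties
  using (length-map; length-++; ++-identityʳ; filter-++; filter-none; filter-some; filter-≐)
open import Data.List.Relation.Unary.All as All using (All; []; _∷_)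
open import Data.List.Relation.Unary.Any using (here; there)
open import Data.Nat as ℕ
  using (ℕ; zero; suc; pred; _+_; _*_; _^_; _∸_; _!; NonZero; _≤_; _<_; _≤′_; ≤′-refl; ≤′-step; z≤n; s≤s)
open import Data.Nat.Combinatorics
  using (_C_; nCk+nC[k+1]≡[n+1]C[k+1]; nCn≡1; k>n⇒nCk≡0; nCk≡n!/k![n-k]!; k![n∸k]!∣n!)
open import Data.Nat.DivMod using (m/n*n≡m)
import Data.Nat.Properties as ℕP
open import Data.Nat.Properties using (_!*_!≢0)
open import Data.Nat.Tactic.RingSolver using (solve-∀)
open import Data.Product as Prod using (Σ; ∃; ∃₂; _×_; _,_; proj₁; proj₂)
open import Data.Rational as ℚ using (ℚ; 0ℚ; _-_; _/_; toℚᵘ)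
import Data.Rational.Properties as ℚP
open import Data.Rational.Unnormalised as ℚᵘ using (mkℚᵘ; *≤*; *≡*)
import Data.Rational.Unnormalised.Properties as ℚᵘP
open import Data.Sum using (_⊎_; inj₁; inj₂)
open import Data.Vec using (Vec; []; _∷_; lookup; _[_]≔_)
open import Data.Vec.Properties using ([]≔-commutes; []≔-lookup; lookup∘update; lookup∘update′)
open import Function using (_∘_; id; case_of_)
open import Relation.Binary.PropositionalEquality
open import Relation.Nullary using (¬_; Dec; yes; no; does; ¬?)
open import Relation.Unary using (Decidable)

open import Algebra.Properties.CommutativeSemigroup ℕP.*-commutativeSemigroup
  using (xy∙z≈y∙xz; x∙yz≈y∙xz; xy∙z≈xz∙y) renaming (interchange to *-interchange)
open import Algebra.Properties.CommutativeSemigroup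
  (CommutativeMonoid.commutativeSemigroup ℚP.+-0-commutativeMonoid) using () renaming (interchange to +-interchange)

private variable
  n m k d : ℕ

Pair : ℕ → Set
Pair n = Fin n × Fin n

orient : Bool → Pair n → Vec Bool n → Vec Bool n
orient c (a , b) x = (x [ a ]≔ c) [ b ]≔ not c

Δ : List (Pair n) → (Vec Bool n → ℚ) → Vec Bool n → ℚ
Δ []       g x = g x
Δ (p ∷ ps) g x = Δ ps g (orient true p x) - Δ ps g (orient false p x)

CornersInSlice : ℕ → List (Pair n) → Vec Bool n → Set
CornersInSlice m []       x = weight x ≡ m
CornersInSlice m (p ∷ ps) x = ∀ c → CornersInSlice m ps (orient c p x)

Avoids : Fin n → List (Pair n) → Set
Avoids i = All λ p → i ≢ proj₁ p × i ≢ proj₂ p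

data Disjoint {n} : List (Pair n) → Set where
  []   : Disjoint []
  cons : ∀ {a b ps} → Avoids a ps → Avoids b ps → Disjoint ps → Disjoint ((a , b) ∷ ps)

weight-[]≔ : (x : Vec Bool n) (i : Fin n) → weight (x [ i ]≔ true) ≡ suc (weight (x [ i ]≔ false))
weight-[]≔ (_ ∷ x)     zero    = refl
weight-[]≔ (false ∷ x) (suc i) = weight-[]≔ x i
weight-[]≔ (true ∷ x)  (suc i) = cong suc (weight-[]≔ x i)

orient-[]≔ : ∀ {a b i} c (x : Vec Bool n) e → i ≢ a → i ≢ b →
             orient c (a , b) (x [ i ]≔ e) ≡ orient c (a , b) x [ i ]≔ e
orient-[]≔ {a = a} {b} {i} c x e i≢a i≢b = begin
  ((x [ i ]≔ e) [ a ]≔ c) [ b ]≔ not c  ≡⟨ cong (_[ b ]≔ not c) ([]≔-commutes x i a i≢a) ⟩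
  ((x [ a ]≔ c) [ i ]≔ e) [ b ]≔ not c  ≡⟨ []≔-commutes (x [ a ]≔ c) i b i≢b ⟩
  ((x [ a ]≔ c) [ b ]≔ not c) [ i ]≔ e  ∎
  where open ≡-Reasoning

Δ-cong : ∀ {g h : Vec Bool n → ℚ} ps {x} → (∀ y → weight y ≡ m → g y ≡ h y) →
         CornersInSlice m ps x → Δ ps g x ≡ Δ ps h x
Δ-cong []       g≗h w       = g≗h _ w
Δ-cong (p ∷ ps) g≗h corners = cong₂ _-_ (Δ-cong ps g≗h (corners true)) (Δ-cong ps g≗h (corners false))

Δ-vanishes : ∀ {g : Vec Bool n → ℚ} ps {x} → (∀ y → weight y ≡ m → g y ≡ 0ℚ) →
             CornersInSlice m ps x → Δ ps g x ≡ 0ℚ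
Δ-vanishes []       g≡0 w       = g≡0 _ w
Δ-vanishes (p ∷ ps) g≡0 corners =
  trans (cong₂ _-_ (Δ-vanishes ps g≡0 (corners true)) (Δ-vanishes ps g≡0 (corners false))) (ℚP.+-inverseʳ 0ℚ)

Ignores : (Vec Bool n → ℚ) → Fin n → Set
Ignores g i = ∀ x c → g (x [ i ]≔ c) ≡ g x

Δ-ignores : ∀ {g : Vec Bool n → ℚ} {i} ps → Avoids i ps → Ignores g i → Ignores (Δ ps g) i
Δ-ignores                []             []                       g-ign x e = g-ign x e
Δ-ignores {g = g} ((a , b) ∷ ps) ((i≢a , i≢b) ∷ avoids) g-ign x e = cong₂ _-_ (corner true) (corner false)
  where
  corner : ∀ c → Δ ps g (orient c (a , b) (x [ _ ]≔ e)) ≡ Δ ps g (orient c (a , b) x)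
  corner c = trans (cong (Δ ps g) (orient-[]≔ c x e i≢a i≢b)) (Δ-ignores ps avoids g-ign _ e)

-- Δ ps g ignores a and b as well, so both corners of (a , b) give the value Δ ps g x.
Δ-ignoredPair : ∀ {g : Vec Bool n → ℚ} {a b ps} → (a , b) ∈ ps → Disjoint ps →
                Ignores g a → Ignores g b → ∀ x → Δ ps g x ≡ 0ℚ
Δ-ignoredPair {g = g} {a} {b} {_ ∷ ps} (here refl) (cons a-avoids b-avoids _) ign-a ign-b x =
  trans (cong₂ _-_ (corner true) (corner false)) (ℚP.+-inverseʳ (Δ ps g x))
  where
  corner : ∀ c → Δ ps g (orient c (a , b) x) ≡ Δ ps g x
  corner c = trans (Δ-ignores ps b-avoids ign-b _ (not c)) (Δ-ignores ps a-avoids ign-a x c)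
Δ-ignoredPair {g = g} {ps = p ∷ ps} (there ab∈ps) (cons _ _ disjoint) ign-a ign-b x =
  trans (cong₂ _-_ (Δ-ignoredPair ab∈ps disjoint ign-a ign-b _) (Δ-ignoredPair ab∈ps disjoint ign-a ign-b _))
        (ℚP.+-inverseʳ 0ℚ)

[]≔-self : (x : Vec Bool n) (i : Fin n) {c : Bool} → lookup x i ≡ c → x [ i ]≔ c ≡ x
[]≔-self x i refl = []≔-lookup x i

weight-true : (x : Vec Bool n) (i : Fin n) → lookup x i ≡ true → weight x ≡ suc (weight (x [ i ]≔ false))
weight-true x i xᵢ≡true = trans (cong weight (sym ([]≔-self x i xᵢ≡true))) (weight-[]≔ x i)

-- Low degree forces vanishing differences

AND-ignores : (T x : Vec Bool n) (i : Fin n) (c : Bool) → lookup T i ≡ false → AND T (x [ i ]≔ c) ≡ AND T x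
AND-ignores (false ∷ T) (_ ∷ x)     zero    c Tᵢ≡false = refl
AND-ignores (false ∷ T) (_ ∷ x)     (suc i) c Tᵢ≡false = AND-ignores T x i c Tᵢ≡false
AND-ignores (true ∷ T)  (false ∷ x) (suc i) c Tᵢ≡false = refl
AND-ignores (true ∷ T)  (true ∷ x)  (suc i) c Tᵢ≡false = AND-ignores T x i c Tᵢ≡false

FreePair : Vec Bool n → List (Pair n) → Set
FreePair T ps = ∃₂ λ a b → (a , b) ∈ ps × lookup T a ≡ false × lookup T b ≡ false

FreePair-∷ : ∀ {T : Vec Bool n} {i p ps} → Avoids i ps → FreePair (T [ i ]≔ false) ps → FreePair T (p ∷ ps)
FreePair-∷ {T = T} {i} i-avoids (a , b , ab∈ps , Ta , Tb) =
  a , b , there ab∈ps , trans (sym (lookup∘update′ (i≢a ∘ sym) T false)) Ta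
                      , trans (sym (lookup∘update′ (i≢b ∘ sym) T false)) Tb
  where
  i≢a = proj₁ (All.lookup i-avoids ab∈ps)
  i≢b = proj₂ (All.lookup i-avoids ab∈ps)

weight-[]≔false< : ∀ (T : Vec Bool n) i {l} → lookup T i ≡ true → weight T ≤ l → weight (T [ i ]≔ false) < l
weight-[]≔false< T i Tᵢ≡true |T|≤l = subst (_≤ _) (weight-true T i Tᵢ≡true) |T|≤l

-- Pigeonhole: each coordinate in T meets at most one of the disjoint pairs.
freePair : ∀ ps (T : Vec Bool n) → Disjoint ps → weight T < length ps → FreePair T ps
freePair ((a , b) ∷ ps) T (cons a-avoids b-avoids disjoint) |T|<|ps|
  with lookup T a in Ta | lookup T b in Tb
... | false | false = a , b , here refl , Ta , Tb
... | true  | _     = FreePair-∷ {T = T} a-avoids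
                        (freePair ps (T [ a ]≔ false) disjoint (weight-[]≔false< T a Ta (ℕP.≤-pred |T|<|ps|)))
... | false | true  = FreePair-∷ {T = T} b-avoids
                        (freePair ps (T [ b ]≔ false) disjoint (weight-[]≔false< T b Tb (ℕP.≤-pred |T|<|ps|)))

sumℚ-map-sub : ∀ {A : Set} (u v : A → ℚ) l →
               sumℚ (map u l) - sumℚ (map v l) ≡ sumℚ (map (λ a → u a - v a) l)
sumℚ-map-sub u v []      = ℚP.+-inverseʳ 0ℚ
sumℚ-map-sub u v (a ∷ l) =
  trans (cong (u a ℚ.+ sumℚ (map u l) ℚ.+_) (ℚP.neg-distrib-+ (v a) (sumℚ (map v l))))
        (trans (+-interchange (u a) _ (ℚ.- v a) _) (cong (u a - v a ℚ.+_) (sumℚ-map-sub u v l)))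

sumℚ-map-zero : ∀ {A : Set} (u : A → ℚ) l → (∀ a → u a ≡ 0ℚ) → sumℚ (map u l) ≡ 0ℚ
sumℚ-map-zero u []      u≡0 = refl
sumℚ-map-zero u (a ∷ l) u≡0 = cong₂ ℚ._+_ (u≡0 a) (sumℚ-map-zero u l u≡0)

Δ-sum : ∀ {A : Set} ps (h : A → Vec Bool n → ℚ) l x →
        Δ ps (λ y → sumℚ (map (λ a → h a y) l)) x ≡ sumℚ (map (λ a → Δ ps (h a) x) l)
Δ-sum []       h l x = refl
Δ-sum (p ∷ ps) h l x =
  trans (cong₂ _-_ (Δ-sum ps h l (orient true p x)) (Δ-sum ps h l (orient false p x)))
        (sumℚ-map-sub (λ a → Δ ps (h a) (orient true p x)) (λ a → Δ ps (h a) (orient false p x)) l)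

DifferencesVanish : ℕ → ℕ → (Vec Bool n → ℤ) → Set
DifferencesVanish m d f = ∀ ps x → length ps ≡ d → Disjoint ps → CornersInSlice m ps x →
                          Δ ps (ℤ→ℚ ∘ f) x ≡ 0ℚ

degree⇒differencesVanish : ∀ (f : Vec Bool n → ℤ) → DegreeAtMost n m k f → DifferencesVanish m (suc k) f
degree⇒differencesVanish {n} {m} {k} f (c , c-high , f≡Σ) ps x |ps|≡1+k disjoint corners = begin
  Δ ps (ℤ→ℚ ∘ f) x                                        ≡⟨ Δ-cong ps f≡Σ corners ⟩
  Δ ps (λ y → sumℚ (map (λ T → monomial T y) (cube n))) x ≡⟨ Δ-sum ps monomial (cube n) x ⟩
  sumℚ (map (λ T → Δ ps (monomial T) x) (cube n))         ≡⟨ sumℚ-map-zero _ (cube n) Δ-monomial ⟩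
  0ℚ                                                      ∎
  where
  open ≡-Reasoning
  monomial : Vec Bool n → Vec Bool n → ℚ
  monomial T y = c T ℚ.* AND T y
  Δ-monomial : ∀ T → Δ ps (monomial T) x ≡ 0ℚ
  Δ-monomial T with k ℕ.<? weight T
  ... | yes k<|T| =
    Δ-vanishes ps (λ y _ → trans (cong (ℚ._* AND T y) (c-high T k<|T|)) (ℚP.*-zeroˡ (AND T y))) corners
  ... | no  k≮|T| with freePair ps T disjoint (subst (weight T <_) (sym |ps|≡1+k) (s≤s (ℕP.≮⇒≥ k≮|T|)))
  ... | a , b , ab∈ps , Ta , Tb =
    Δ-ignoredPair ab∈ps disjoint (λ y e → cong (c T ℚ.*_) (AND-ignores T y a e Ta))
                                 (λ y e → cong (c T ℚ.*_) (AND-ignores T y b e Tb)) x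

-- Restricting the first coordinate

liftPairs : List (Pair n) → List (Pair (suc n))
liftPairs = map (Prod.map suc suc)

Avoids-lift : ∀ {i : Fin n} ps → Avoids i ps → Avoids (suc i) (liftPairs ps)
Avoids-lift []       []                      = []
Avoids-lift (_ ∷ ps) ((i≢a , i≢b) ∷ avoids) =
  (i≢a ∘ suc-injective , i≢b ∘ suc-injective) ∷ Avoids-lift ps avoids

zero-avoids-lift : (ps : List (Pair n)) → Avoids zero (liftPairs ps)
zero-avoids-lift []       = []
zero-avoids-lift (_ ∷ ps) = ((λ ()) , (λ ())) ∷ zero-avoids-lift ps

Disjoint-lift : ∀ {ps : List (Pair n)} → Disjoint ps → Disjoint (liftPairs ps)
Disjoint-lift []                              = []
Disjoint-lift (cons a-avoids b-avoids disjoint) =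
  cons (Avoids-lift _ a-avoids) (Avoids-lift _ b-avoids) (Disjoint-lift disjoint)

Δ-lift : ∀ ps (g : Vec Bool (suc n) → ℚ) c y → Δ (liftPairs ps) g (c ∷ y) ≡ Δ ps (g ∘ (c ∷_)) y
Δ-lift []       g c y = refl
Δ-lift (p ∷ ps) g c y = cong₂ _-_ (Δ-lift ps g c _) (Δ-lift ps g c _)

CornersInSlice-lift : ∀ {m′} ps {c} {y : Vec Bool n} →
                      (∀ {z : Vec Bool n} → weight z ≡ m → weight (c ∷ z) ≡ m′) →
                      CornersInSlice m ps y → CornersInSlice m′ (liftPairs ps) (c ∷ y)
CornersInSlice-lift []       extend w       = extend w
CornersInSlice-lift (p ∷ ps) extend corners = λ e → CornersInSlice-lift ps extend (corners e)

differencesVanish-restrict : ∀ {m′} c (f : Vec Bool (suc n) → ℤ) →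
                             (∀ {z : Vec Bool n} → weight z ≡ m → weight (c ∷ z) ≡ m′) →
                             DifferencesVanish m′ d f → DifferencesVanish m d (f ∘ (c ∷_))
differencesVanish-restrict c f extend vanish ps x |ps|≡d disjoint corners =
  trans (sym (Δ-lift ps _ c x))
        (vanish (liftPairs ps) (c ∷ x) (trans (length-map _ ps) |ps|≡d) (Disjoint-lift disjoint)
                (CornersInSlice-lift ps extend corners))

corners-raise : ∀ {j : Fin n} ps {x} → Avoids j ps →
                CornersInSlice m ps (x [ j ]≔ false) → CornersInSlice (suc m) ps (x [ j ]≔ true)
corners-raise [] {x} [] w = trans (weight-[]≔ x _) (cong suc w)
corners-raise {m = m} ((a , b) ∷ ps) {x} ((j≢a , j≢b) ∷ avoids) corners c =
  subst (CornersInSlice (suc m) ps) (sym (orient-[]≔ c x true j≢a j≢b))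
        (corners-raise ps avoids (subst (CornersInSlice m ps) (orient-[]≔ c x false j≢a j≢b) (corners c)))

corners-lower : ∀ {j : Fin n} ps {x} → Avoids j ps →
                CornersInSlice (suc m) ps (x [ j ]≔ true) → CornersInSlice m ps (x [ j ]≔ false)
corners-lower [] {x} [] w = ℕP.suc-injective (trans (sym (weight-[]≔ x _)) w)
corners-lower {m = m} ((a , b) ∷ ps) {x} ((j≢a , j≢b) ∷ avoids) corners c =
  subst (CornersInSlice m ps) (sym (orient-[]≔ c x false j≢a j≢b))
        (corners-lower ps avoids (subst (CornersInSlice (suc m) ps) (orient-[]≔ c x true j≢a j≢b) (corners c)))

trueCoordinate : (x : Vec Bool n) → 0 < weight x → ∃ λ j → lookup x j ≡ true
trueCoordinate (true ∷ x)  _   = zero , refl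
trueCoordinate (false ∷ x) 0<w = Prod.map suc id (trueCoordinate x 0<w)

falseCoordinate : (x : Vec Bool n) → weight x < n → ∃ λ j → lookup x j ≡ false
falseCoordinate (false ∷ x) _   = zero , refl
falseCoordinate (true ∷ x)  w<n = Prod.map suc id (falseCoordinate x (ℕP.≤-pred w<n))

lookup-cleared : ∀ {a b j : Fin n} (x : Vec Bool n) c → lookup ((x [ a ]≔ c) [ b ]≔ c) j ≡ not c →
                 j ≢ a × j ≢ b × lookup x j ≡ not c
lookup-cleared {a = a} {b} {j} x c xⱼ≡¬c with j ≟ᶠ b
... | yes refl = ⊥-elim (not-¬ (lookup∘update j (x [ a ]≔ c) c) xⱼ≡¬c)
... | no j≢b with j ≟ᶠ a
...   | yes refl = ⊥-elim (not-¬ (trans (lookup∘update′ j≢b (x [ j ]≔ c) c) (lookup∘update j x c)) xⱼ≡¬c)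
...   | no j≢a   =
  j≢a , j≢b , trans (sym (lookup∘update′ j≢a x c)) (trans (sym (lookup∘update′ j≢b (x [ a ]≔ c) c)) xⱼ≡¬c)

-- Induction on the pairs: fixing both coordinates of the first pair to false (to true, for falseOutsidePairs)
-- shifts the weight of every remaining corner by one.
trueOutsidePairs : ∀ ps {M} (x : Vec Bool n) → Disjoint ps → CornersInSlice M ps x → length ps < M →
                   ∃ λ j → Avoids j ps × lookup x j ≡ true
trueOutsidePairs [] x [] w 0<M = Prod.map id ([] ,_) (trueCoordinate x (subst (0 <_) (sym w) 0<M))
trueOutsidePairs ((a , b) ∷ ps) {suc M} x (cons _ b-avoids disjoint) corners (s≤s |ps|<M)
  with trueOutsidePairs ps ((x [ a ]≔ false) [ b ]≔ false) disjoint
                        (corners-lower ps b-avoids (corners false)) |ps|<M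
... | j , j-avoids , zⱼ≡true with lookup-cleared x false zⱼ≡true
... | j≢a , j≢b , xⱼ≡true = j , (j≢a , j≢b) ∷ j-avoids , xⱼ≡true

falseOutsidePairs : ∀ ps {M} (x : Vec Bool n) → Disjoint ps → CornersInSlice M ps x → M + length ps < n →
                    ∃ λ j → Avoids j ps × lookup x j ≡ false
falseOutsidePairs [] x [] w M+0<n =
  Prod.map id ([] ,_) (falseCoordinate x (subst (_< _) (trans (ℕP.+-identityʳ _) (sym w)) M+0<n))
falseOutsidePairs {n} ((a , b) ∷ ps) {M} x (cons _ b-avoids disjoint) corners M+|ps|<n
  with falseOutsidePairs ps ((x [ a ]≔ true) [ b ]≔ true) disjoint
                         (corners-raise ps b-avoids (corners true)) (subst (_< n) (ℕP.+-suc M (length ps)) M+|ps|<n)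
... | j , j-avoids , zⱼ≡false with lookup-cleared x true zⱼ≡false
... | j≢a , j≢b , xⱼ≡false = j , (j≢a , j≢b) ∷ j-avoids , xⱼ≡false

0-x≡0⇒x≡0 : ∀ q → 0ℚ - q ≡ 0ℚ → q ≡ 0ℚ
0-x≡0⇒x≡0 q 0-q≡0 = ℚP.neg-injective (trans (sym (ℚP.+-identityˡ (ℚ.- q))) 0-q≡0)

x-0≡0⇒x≡0 : ∀ q → q - 0ℚ ≡ 0ℚ → q ≡ 0ℚ
x-0≡0⇒x≡0 q q-0≡0 = trans (sym (ℚP.+-identityʳ q)) q-0≡0

headPair : Fin n → Pair (suc n)
headPair j = zero , suc j

headPair-difference : ∀ {m′} (f : Vec Bool (suc n) → ℤ) → DifferencesVanish m′ (suc d) f →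
                      ∀ {j ps} c x → Avoids j ps → Disjoint ps → length ps ≡ d →
                      CornersInSlice m′ (headPair j ∷ liftPairs ps) (c ∷ x) →
                      Δ ps (ℤ→ℚ ∘ f ∘ (true ∷_)) (x [ j ]≔ false) - Δ ps (ℤ→ℚ ∘ f ∘ (false ∷_)) (x [ j ]≔ true) ≡ 0ℚ
headPair-difference f vanish {j} {ps} c x j-avoids disjoint |ps|≡d corners =
  trans (sym (cong₂ _-_ (Δ-lift ps (ℤ→ℚ ∘ f) true _) (Δ-lift ps (ℤ→ℚ ∘ f) false _)))
        (vanish (headPair j ∷ liftPairs ps) (c ∷ x) (cong suc (trans (length-map _ ps) |ps|≡d))
                (cons (zero-avoids-lift ps) (Avoids-lift ps j-avoids) (Disjoint-lift disjoint)) corners)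

-- With x_j = 1 and j off the pairs, the new pair (0 , 1 + j) has one corner at x in the false half and
-- the other in the true half, where f vanishes.
differencesVanish-falseHalf : ∀ (f : Vec Bool (suc n) → ℤ) → DifferencesVanish (suc m) (suc d) f →
                              VanishesOnSlice n m (f ∘ (true ∷_)) → d ≤ m →
                              DifferencesVanish (suc m) d (f ∘ (false ∷_))
differencesVanish-falseHalf {m = m} f vanish f₁≡0 d≤m ps x |ps|≡d disjoint corners =
  0-x≡0⇒x≡0 _ (begin
    0ℚ - Δ ps F₀ x
      ≡⟨ cong₂ _-_ (sym (Δ-vanishes ps (λ y w → cong ℤ→ℚ (f₁≡0 y w)) cleared)) (cong (Δ ps F₀) (sym x[j]≔true≡x)) ⟩
    Δ ps F₁ (x [ j ]≔ false) - Δ ps F₀ (x [ j ]≔ true)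
      ≡⟨ headPair-difference f vanish false x j-avoids disjoint |ps|≡d head-corners ⟩
    0ℚ ∎)
  where
  open ≡-Reasoning
  F₀ = ℤ→ℚ ∘ f ∘ (false ∷_)
  F₁ = ℤ→ℚ ∘ f ∘ (true ∷_)
  found = trueOutsidePairs ps x disjoint corners (s≤s (subst (_≤ m) (sym |ps|≡d) d≤m))
  j = proj₁ found
  j-avoids = proj₁ (proj₂ found)
  x[j]≔true≡x = []≔-self x j (proj₂ (proj₂ found))
  cleared : CornersInSlice m ps (x [ j ]≔ false)
  cleared = corners-lower ps j-avoids (subst (CornersInSlice (suc m) ps) (sym x[j]≔true≡x) corners)
  head-corners : CornersInSlice (suc m) (headPair j ∷ liftPairs ps) (false ∷ x)
  head-corners true  = CornersInSlice-lift ps (cong suc) cleared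
  head-corners false = CornersInSlice-lift ps id (subst (CornersInSlice (suc m) ps) (sym x[j]≔true≡x) corners)

differencesVanish-trueHalf : ∀ (f : Vec Bool (suc n) → ℤ) → DifferencesVanish (suc m) (suc d) f →
                             VanishesOnSlice n (suc m) (f ∘ (false ∷_)) → m + d < n →
                             DifferencesVanish m d (f ∘ (true ∷_))
differencesVanish-trueHalf {n} {m} {d} f vanish f₀≡0 m+d<n ps x |ps|≡d disjoint corners =
  x-0≡0⇒x≡0 _ (begin
    Δ ps F₁ x - 0ℚ
      ≡⟨ cong₂ _-_ (cong (Δ ps F₁) (sym x[j]≔false≡x)) (sym (Δ-vanishes ps (λ y w → cong ℤ→ℚ (f₀≡0 y w)) filled)) ⟩
    Δ ps F₁ (x [ j ]≔ false) - Δ ps F₀ (x [ j ]≔ true)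
      ≡⟨ headPair-difference f vanish true x j-avoids disjoint |ps|≡d head-corners ⟩
    0ℚ ∎)
  where
  open ≡-Reasoning
  F₀ = ℤ→ℚ ∘ f ∘ (false ∷_)
  F₁ = ℤ→ℚ ∘ f ∘ (true ∷_)
  found = falseOutsidePairs ps x disjoint corners (subst (λ l → m + l < n) (sym |ps|≡d) m+d<n)
  j = proj₁ found
  j-avoids = proj₁ (proj₂ found)
  x[j]≔false≡x = []≔-self x j (proj₂ (proj₂ found))
  filled : CornersInSlice (suc m) ps (x [ j ]≔ true)
  filled = corners-raise ps j-avoids (subst (CornersInSlice m ps) (sym x[j]≔false≡x) corners)
  head-corners : CornersInSlice (suc m) (headPair j ∷ liftPairs ps) (true ∷ x)
  head-corners true  =
    CornersInSlice-lift ps (cong suc) (subst (CornersInSlice m ps) (sym x[j]≔false≡x) corners)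
  head-corners false = CornersInSlice-lift ps id filled

differencesVanish-zero : ∀ (f : Vec Bool n → ℤ) → DifferencesVanish m 0 f → VanishesOnSlice n m f
differencesVanish-zero f vanish x w = ℤ→ℚ-injective (vanish [] x refl [] w)
  where
  ℤ→ℚ-injective : ∀ {z} → ℤ→ℚ z ≡ 0ℚ → z ≡ + 0
  ℤ→ℚ-injective {z} z/1≡0 = trans (sym (ℚP.↥-/ z 1)) (cong (λ q → ℚ.↥ q ℤ.* gcd z (+ 1)) z/1≡0)

-- The slice and its nonzeros

filter-map : ∀ {A B : Set} {P : B → Set} (P? : Decidable P) (g : A → B) xs →
             filter P? (map g xs) ≡ map g (filter (P? ∘ g) xs)
filter-map P? g []       = refl
filter-map P? g (x ∷ xs) with does (P? (g x))
... | true  = cong (g x ∷_) (filter-map P? g xs)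
... | false = filter-map P? g xs

length-filter-map : ∀ {A B : Set} {P : B → Set} (P? : Decidable P) (g : A → B) xs →
                    length (filter P? (map g xs)) ≡ length (filter (P? ∘ g) xs)
length-filter-map P? g xs = trans (cong length (filter-map P? g xs)) (length-map g (filter (P? ∘ g) xs))

slice-suc : ∀ n m → slice (suc n) m ≡
                    map (false ∷_) (slice n m) ++ map (true ∷_) (filter (λ x → suc (weight x) ℕ.≟ m) (cube n))
slice-suc n m =
  trans (filter-++ _ (map (false ∷_) (cube n)) _) (cong₂ _++_ (filter-map _ _ (cube n)) (filter-map _ _ (cube n)))

slice-suc-zero : ∀ n → slice (suc n) zero ≡ map (false ∷_) (slice n zero)
slice-suc-zero n = begin
  slice (suc n) zero
    ≡⟨ slice-suc n zero ⟩
  map (false ∷_) (slice n zero) ++ map (true ∷_) (filter _ (cube n))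
    ≡⟨ cong (λ l → map (false ∷_) (slice n zero) ++ map (true ∷_) l) none ⟩
  map (false ∷_) (slice n zero) ++ []
    ≡⟨ ++-identityʳ _ ⟩
  map (false ∷_) (slice n zero) ∎
  where
  open ≡-Reasoning
  none = filter-none (λ x → suc (weight x) ℕ.≟ zero) (All.universal (λ _ ()) (cube n))

slice-suc-suc : ∀ n m → slice (suc n) (suc m) ≡ map (false ∷_) (slice n (suc m)) ++ map (true ∷_) (slice n m)
slice-suc-suc n m = trans (slice-suc n (suc m)) (cong (λ l → map (false ∷_) (slice n (suc m)) ++ map (true ∷_) l)
                                                      (filter-≐ _ _ (ℕP.suc-injective , cong suc) (cube n)))

length-slice : ∀ n m → length (slice n m) ≡ n C m
length-slice zero    zero    = refl
length-slice zero    (suc m) = refl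
length-slice (suc n) zero    =
  trans (cong length (slice-suc-zero n)) (trans (length-map _ (slice n zero)) (length-slice n zero))
length-slice (suc n) (suc m) = begin
  length (slice (suc n) (suc m))
    ≡⟨ cong length (slice-suc-suc n m) ⟩
  length (map (false ∷_) (slice n (suc m)) ++ map (true ∷_) (slice n m))
    ≡⟨ length-++ (map (false ∷_) (slice n (suc m))) ⟩
  length (map (false ∷_) (slice n (suc m))) + length (map (true ∷_) (slice n m))
    ≡⟨ cong₂ _+_ (length-map _ (slice n (suc m))) (length-map _ (slice n m)) ⟩
  length (slice n (suc m)) + length (slice n m)
    ≡⟨ cong₂ _+_ (length-slice n (suc m)) (length-slice n m) ⟩
  n C suc m + n C m
    ≡⟨ ℕP.+-comm (n C suc m) (n C m) ⟩
  n C m + n C suc m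
    ≡⟨ nCk+nC[k+1]≡[n+1]C[k+1] n m ⟩
  suc n C suc m ∎
  where open ≡-Reasoning

nonzeroCount-suc-suc : ∀ n m (f : Vec Bool (suc n) → ℤ) →
                       nonzeroCount (suc n) (suc m) f ≡
                       nonzeroCount n (suc m) (f ∘ (false ∷_)) + nonzeroCount n m (f ∘ (true ∷_))
nonzeroCount-suc-suc n m f = begin
  length (filter _ (slice (suc n) (suc m)))
    ≡⟨ cong (length ∘ filter _) (slice-suc-suc n m) ⟩
  length (filter _ (map (false ∷_) (slice n (suc m)) ++ map (true ∷_) (slice n m)))
    ≡⟨ cong length (filter-++ _ (map (false ∷_) (slice n (suc m))) _) ⟩
  length (filter _ (map (false ∷_) (slice n (suc m))) ++ filter _ (map (true ∷_) (slice n m)))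
    ≡⟨ length-++ (filter _ (map (false ∷_) (slice n (suc m)))) ⟩
  length (filter _ (map (false ∷_) (slice n (suc m)))) + length (filter _ (map (true ∷_) (slice n m)))
    ≡⟨ cong₂ _+_ (length-filter-map _ _ (slice n (suc m))) (length-filter-map _ _ (slice n m)) ⟩
  nonzeroCount n (suc m) (f ∘ (false ∷_)) + nonzeroCount n m (f ∘ (true ∷_)) ∎
  where open ≡-Reasoning

∈-cube : (x : Vec Bool n) → x ∈ cube n
∈-cube []          = here refl
∈-cube (false ∷ x) = ∈-++⁺ˡ (∈-map⁺ (false ∷_) (∈-cube x))
∈-cube (true ∷ x)  = ∈-++⁺ʳ (map (false ∷_) (cube _)) (∈-map⁺ (true ∷_) (∈-cube x))

nonzeroCount≡0⇒vanishes : ∀ n m (f : Vec Bool n → ℤ) → nonzeroCount n m f ≡ 0 → VanishesOnSlice n m f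
nonzeroCount≡0⇒vanishes n m f count≡0 x w with f x ℤ.≟ + 0
... | yes fx≡0 = fx≡0
... | no  fx≢0 = ⊥-elim (ℕP.<⇒≢ (filter-some _ (lose (∈-filter⁺ _ (∈-cube x) w) fx≢0)) (sym count≡0))

vanishes⇒nonzeroCount≡0 : ∀ n m (f : Vec Bool n → ℤ) → VanishesOnSlice n m f → nonzeroCount n m f ≡ 0
vanishes⇒nonzeroCount≡0 n m f f≡0 =
  cong length (filter-none (λ x → ¬? (f x ℤ.≟ + 0)) {xs = slice n m} (All.tabulate zero-at))
  where
  zero-at : ∀ {x} → x ∈ slice n m → ¬ (f x ≢ + 0)
  zero-at x∈slice fx≢0 = fx≢0 (f≡0 _ (proj₂ (∈-filter⁻ (λ y → weight y ℕ.≟ m) {xs = cube n} x∈slice)))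

-- The lower bound C(n − 2k, m − k) on the number of nonzeros

C-suc-suc : ∀ n k → suc n C suc k ≡ n C k + n C suc k
C-suc-suc n k = sym (nCk+nC[k+1]≡[n+1]C[k+1] n k)

C-monoˡ : ∀ {a b} k → a ≤ b → a C k ≤ b C k
C-monoˡ k a≤b = go k (ℕP.≤⇒≤′ a≤b)
  where
  go : ∀ {a b} k → a ≤′ b → a C k ≤ b C k
  go k       ≤′-refl            = ℕP.≤-refl
  go zero    (≤′-step a≤′b)     = go zero a≤′b
  go (suc k) (≤′-step {b} a≤′b) =
    ℕP.≤-trans (go (suc k) a≤′b) (ℕP.≤-trans (ℕP.m≤n+m _ (b C k)) (ℕP.≤-reflexive (sym (C-suc-suc b k))))

C≤1 : ∀ {a b} → a ≤ b → a C b ≤ 1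
C≤1 {a} a≤b with ℕP.m≤n⇒m<n∨m≡n a≤b
... | inj₁ a<b  = subst (_≤ 1) (sym (k>n⇒nCk≡0 a<b)) z≤n
... | inj₂ refl = ℕP.≤-reflexive (nCn≡1 a)

-- C(n − 2k, m − k); with truncated subtraction it is 1 once k ≥ m.
sliceBound : ℕ → ℕ → ℕ → ℕ
sliceBound n m k = (n ∸ k ∸ k) C (m ∸ k)

pred-C≤C-suc : ∀ t j → 0 < j → pred t C j ≤ t C suc j
pred-C≤C-suc zero    (suc j) _ = z≤n
pred-C≤C-suc (suc t) j       _ = ℕP.≤-trans (ℕP.m≤m+n (t C j) _) (ℕP.≤-reflexive (sym (C-suc-suc t j)))

suc-C-∸≤ : ∀ t m k → suc t C (suc m ∸ k) ≤ t C (suc m ∸ k) + t C (m ∸ k)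
suc-C-∸≤ t m k with k ℕ.≤? m
... | yes k≤m rewrite ℕP.+-∸-assoc 1 k≤m =
  ℕP.≤-reflexive (trans (C-suc-suc t (m ∸ k)) (ℕP.+-comm (t C (m ∸ k)) _))
... | no  k≰m rewrite ℕP.m≤n⇒m∸n≡0 (ℕP.≰⇒> k≰m) | ℕP.m≤n⇒m∸n≡0 (ℕP.<⇒≤ (ℕP.≰⇒> k≰m)) = s≤s z≤n

suc-∸-≤ : ∀ n k → suc n ∸ k ≤ suc (n ∸ k)
suc-∸-≤ n       zero    = ℕP.≤-refl
suc-∸-≤ zero    (suc k) = subst (_≤ 1) (sym (ℕP.0∸n≡0 k)) z≤n
suc-∸-≤ (suc n) (suc k) = suc-∸-≤ n k

sliceBound-pascal : ∀ n m k → sliceBound (suc n) (suc m) k ≤ sliceBound n (suc m) k + sliceBound n m k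
sliceBound-pascal n m k = ℕP.≤-trans (C-monoˡ (suc m ∸ k) suc-n∸2k≤) (suc-C-∸≤ (n ∸ k ∸ k) m k)
  where
  suc-n∸2k≤ : suc n ∸ k ∸ k ≤ suc (n ∸ k ∸ k)
  suc-n∸2k≤ = ℕP.≤-trans (ℕP.∸-monoˡ-≤ k (suc-∸-≤ n k)) (suc-∸-≤ (n ∸ k) k)

sliceBound-dropFalse : ∀ n m k → k < m → sliceBound (suc n) (suc m) (suc k) ≤ sliceBound n (suc m) k
sliceBound-dropFalse n m k k<m = begin
  (n ∸ k ∸ suc k) C (m ∸ k)      ≡⟨ cong (_C (m ∸ k)) (sym (ℕP.pred[m∸n]≡m∸[1+n] (n ∸ k) k)) ⟩
  pred (n ∸ k ∸ k) C (m ∸ k)     ≤⟨ pred-C≤C-suc (n ∸ k ∸ k) (m ∸ k) (ℕP.m<n⇒0<n∸m k<m) ⟩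
  (n ∸ k ∸ k) C suc (m ∸ k)      ≡⟨ cong ((n ∸ k ∸ k) C_) (sym (ℕP.+-∸-assoc 1 (ℕP.<⇒≤ k<m))) ⟩
  (n ∸ k ∸ k) C (suc m ∸ k)      ∎
  where open ℕP.≤-Reasoning

sliceBound-dropTrue : ∀ n m k → sliceBound (suc n) (suc m) (suc k) ≤ sliceBound n m k
sliceBound-dropTrue n m k = C-monoˡ (m ∸ k) (ℕP.∸-monoʳ-≤ (n ∸ k) (ℕP.n≤1+n k))

m≤k⇒sliceBound≡1 : ∀ n m k → m ≤ k → sliceBound n m k ≡ 1
m≤k⇒sliceBound≡1 n m k m≤k = cong ((n ∸ k ∸ k) C_) (ℕP.m≤n⇒m∸n≡0 m≤k)

n≤m+k⇒sliceBound≤1 : ∀ n m k → n ≤ m + k → sliceBound n m k ≤ 1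
n≤m+k⇒sliceBound≤1 n m k n≤m+k = C≤1 (begin
  n ∸ k ∸ k           ≤⟨ ℕP.∸-monoˡ-≤ k (ℕP.∸-monoˡ-≤ k n≤m+k) ⟩
  m + k ∸ k ∸ k       ≡⟨ cong (_∸ k) (ℕP.m+n∸n≡m m k) ⟩
  m ∸ k               ∎)
  where open ℕP.≤-Reasoning

NonzeroCountBound : ℕ → ℕ → ℕ → Set
NonzeroCountBound n m k = ∀ (f : Vec Bool n → ℤ) → DifferencesVanish m (suc k) f →
                          0 < nonzeroCount n m f → sliceBound n m k ≤ nonzeroCount n m f

0<count⇒¬vanishes : ∀ {n m} (f : Vec Bool n → ℤ) → 0 < nonzeroCount n m f → ¬ VanishesOnSlice n m f
0<count⇒¬vanishes {n} {m} f 0<count f≡0 = ℕP.<⇒≢ 0<count (sym (vanishes⇒nonzeroCount≡0 n m f f≡0))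

falseHalf-bound : (∀ k → NonzeroCountBound n (suc m) k) → ∀ k (f : Vec Bool (suc n) → ℤ) →
                  DifferencesVanish (suc m) (suc k) f → VanishesOnSlice n m (f ∘ (true ∷_)) →
                  0 < nonzeroCount n (suc m) (f ∘ (false ∷_)) →
                  sliceBound (suc n) (suc m) k ≤ nonzeroCount n (suc m) (f ∘ (false ∷_))
falseHalf-bound bound zero f vanish f₁≡0 0<c₀ =
  ⊥-elim (0<count⇒¬vanishes _ 0<c₀ (differencesVanish-zero _ (differencesVanish-falseHalf f vanish f₁≡0 z≤n)))
falseHalf-bound {n} {m} bound (suc k) f vanish f₁≡0 0<c₀ with suc k ℕ.≤? m
... | yes k<m = ℕP.≤-trans (sliceBound-dropFalse n m k k<m)
                           (bound k (f ∘ (false ∷_)) (differencesVanish-falseHalf f vanish f₁≡0 k<m) 0<c₀)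
... | no  k≮m = ℕP.≤-trans (ℕP.≤-reflexive (m≤k⇒sliceBound≡1 (suc n) (suc m) (suc k) (ℕP.≰⇒> k≮m))) 0<c₀

trueHalf-bound : (∀ k → NonzeroCountBound n m k) → ∀ k (f : Vec Bool (suc n) → ℤ) →
                 DifferencesVanish (suc m) (suc k) f → VanishesOnSlice n (suc m) (f ∘ (false ∷_)) →
                 0 < nonzeroCount n m (f ∘ (true ∷_)) →
                 sliceBound (suc n) (suc m) k ≤ nonzeroCount n m (f ∘ (true ∷_))
trueHalf-bound {n} {m} bound k f vanish f₀≡0 0<c₁ with m + k ℕ.<? n
trueHalf-bound bound zero    f vanish f₀≡0 0<c₁ | yes m+k<n =
  ⊥-elim (0<count⇒¬vanishes _ 0<c₁ (differencesVanish-zero _ (differencesVanish-trueHalf f vanish f₀≡0 m+k<n)))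
trueHalf-bound {n} {m} bound (suc k) f vanish f₀≡0 0<c₁ | yes m+k<n =
  ℕP.≤-trans (sliceBound-dropTrue n m k) (bound k (f ∘ (true ∷_)) (differencesVanish-trueHalf f vanish f₀≡0 m+k<n) 0<c₁)
trueHalf-bound {n} {m} bound k       f vanish f₀≡0 0<c₁ | no  m+k≮n =
  ℕP.≤-trans (n≤m+k⇒sliceBound≤1 (suc n) (suc m) k (s≤s (ℕP.≮⇒≥ m+k≮n))) 0<c₁

nonzeroCount-bound : ∀ n m k → NonzeroCountBound n m k
nonzeroCount-bound zero    m       k f _ 0<count = ℕP.≤-trans (n≤m+k⇒sliceBound≤1 zero m k z≤n) 0<count
nonzeroCount-bound (suc n) zero    k f _ 0<count =
  ℕP.≤-trans (ℕP.≤-reflexive (m≤k⇒sliceBound≡1 (suc n) zero k z≤n)) 0<count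
nonzeroCount-bound (suc n) (suc m) k f vanish 0<count =
  subst (sliceBound (suc n) (suc m) k ≤_) (sym split) (halves (c₀ ℕ.≟ 0) (c₁ ℕ.≟ 0))
  where
  f₀ = f ∘ (false ∷_)
  f₁ = f ∘ (true ∷_)
  c₀ = nonzeroCount n (suc m) f₀
  c₁ = nonzeroCount n m f₁
  split : nonzeroCount (suc n) (suc m) f ≡ c₀ + c₁
  split = nonzeroCount-suc-suc n m f
  halves : Dec (c₀ ≡ 0) → Dec (c₁ ≡ 0) → sliceBound (suc n) (suc m) k ≤ c₀ + c₁
  halves (yes c₀≡0) (yes c₁≡0) = ⊥-elim (ℕP.<⇒≢ 0<count (sym (trans split (cong₂ _+_ c₀≡0 c₁≡0))))
  halves (no  c₀≢0) (no  c₁≢0) = ℕP.≤-trans (sliceBound-pascal n m k) (ℕP.+-mono-≤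
    (nonzeroCount-bound n (suc m) k f₀ (differencesVanish-restrict false f id vanish) (ℕP.n≢0⇒n>0 c₀≢0))
    (nonzeroCount-bound n m k f₁ (differencesVanish-restrict true f (cong suc) vanish) (ℕP.n≢0⇒n>0 c₁≢0)))
  halves (no  c₀≢0) (yes c₁≡0) = ℕP.≤-trans
    (falseHalf-bound (nonzeroCount-bound n (suc m)) k f vanish (nonzeroCount≡0⇒vanishes n m f₁ c₁≡0) (ℕP.n≢0⇒n>0 c₀≢0))
    (ℕP.m≤m+n c₀ c₁)
  halves (yes c₀≡0) (no  c₁≢0) = ℕP.≤-trans
    (trueHalf-bound (nonzeroCount-bound n m) k f vanish (nonzeroCount≡0⇒vanishes n (suc m) f₀ c₀≡0) (ℕP.n≢0⇒n>0 c₁≢0))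
    (ℕP.m≤n+m c₁ c₀)

-- Comparing C(n − 2k, m − k) with C(n, m)

^-distribʳ-* : ∀ a b k → (a * b) ^ k ≡ a ^ k * b ^ k
^-distribʳ-* a b zero    = refl
^-distribʳ-* a b (suc k) = trans (cong (a * b *_) (^-distribʳ-* a b k)) (*-interchange a b (a ^ k) (b ^ k))

^-comm : ∀ a i k → (a ^ i) ^ k ≡ (a ^ k) ^ i
^-comm a i k = trans (ℕP.^-*-assoc a i k) (trans (cong (a ^_) (ℕP.*-comm i k)) (sym (ℕP.^-*-assoc a k i)))

bernoulli : ∀ N i r → i + r ≡ N → suc N ^ i * r ≤ N ^ suc i
bernoulli N zero    r r≡N     = ℕP.≤-reflexive (trans (ℕP.+-identityʳ r) (trans r≡N (sym (ℕP.*-identityʳ N))))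
bernoulli N (suc i) r i+r≡N = begin
  suc N ^ suc i * r           ≡⟨ xy∙z≈y∙xz (suc N) (suc N ^ i) r ⟩
  suc N ^ i * (suc N * r)     ≤⟨ ℕP.*-monoʳ-≤ (suc N ^ i) 1+N*r≤N*1+r ⟩
  suc N ^ i * (N * suc r)     ≡⟨ x∙yz≈y∙xz (suc N ^ i) N (suc r) ⟩
  N * (suc N ^ i * suc r)     ≤⟨ ℕP.*-monoʳ-≤ N (bernoulli N i (suc r) (trans (ℕP.+-suc i r) i+r≡N)) ⟩
  N * N ^ suc i               ∎
  where
  open ℕP.≤-Reasoning
  1+N*r≤N*1+r : suc N * r ≤ N * suc r
  1+N*r≤N*1+r = begin
    r + N * r    ≤⟨ ℕP.+-monoˡ-≤ (N * r) (ℕP.≤-trans (ℕP.m≤n+m r (suc i)) (ℕP.≤-reflexive i+r≡N)) ⟩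
    N + N * r    ≡⟨ sym (ℕP.*-suc N r) ⟩
    N * suc r    ∎

suc-^≤2*^ : ∀ h N → h + h ≤ N → suc N ^ h ≤ 2 * N ^ h
suc-^≤2*^ zero      N _     = s≤s z≤n
suc-^≤2*^ h@(suc _) N 2h≤N = ℕP.*-cancelʳ-≤ (suc N ^ h) (2 * N ^ h) r {{r≢0}} (begin
  suc N ^ h * r     ≤⟨ bernoulli N h r (ℕP.m+[n∸m]≡n (ℕP.m+n≤o⇒m≤o h 2h≤N)) ⟩
  N * N ^ h         ≤⟨ ℕP.*-monoˡ-≤ (N ^ h) N≤2r ⟩
  2 * r * N ^ h     ≡⟨ xy∙z≈xz∙y 2 r (N ^ h) ⟩
  2 * N ^ h * r     ∎)
  where
  open ℕP.≤-Reasoning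
  r = N ∸ h
  h≤r : h ≤ r
  h≤r = ℕP.m+n≤o⇒m≤o∸n h 2h≤N
  r≢0 : NonZero r
  r≢0 = ℕ.>-nonZero (ℕP.≤-trans (s≤s z≤n) h≤r)
  N≤2r : N ≤ 2 * r
  N≤2r = begin
    N               ≡⟨ sym (ℕP.m+[n∸m]≡n (ℕP.m+n≤o⇒m≤o h 2h≤N)) ⟩
    h + r           ≤⟨ ℕP.+-monoˡ-≤ r h≤r ⟩
    r + r           ≡⟨ cong (_+_ r) (sym (ℕP.+-identityʳ r)) ⟩
    2 * r           ∎

data Parity : ℕ → Set where
  even : ∀ h → Parity (h + h)
  odd  : ∀ h → Parity (suc (h + h))

parity : ∀ j → Parity j
parity zero = even zero
parity (suc j) with parity j
... | even h = odd h
... | odd h  = subst Parity (cong suc (ℕP.+-suc h h)) (even (suc h))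

suc-^≤4*^-even : ∀ h N → h + h ≤ N → suc N ^ (h + h) ≤ 4 * N ^ (h + h)
suc-^≤4*^-even h N 2h≤N = begin
  suc N ^ (h + h)               ≡⟨ ℕP.^-distribˡ-+-* (suc N) h h ⟩
  suc N ^ h * suc N ^ h         ≤⟨ ℕP.*-mono-≤ (suc-^≤2*^ h N 2h≤N) (suc-^≤2*^ h N 2h≤N) ⟩
  2 * N ^ h * (2 * N ^ h)       ≡⟨ *-interchange 2 (N ^ h) 2 (N ^ h) ⟩
  4 * (N ^ h * N ^ h)           ≡⟨ cong (4 *_) (sym (ℕP.^-distribˡ-+-* N h h)) ⟩
  4 * N ^ (h + h)               ∎
  where open ℕP.≤-Reasoning

suc-^≤8*^ : ∀ j N → j ≤ N → suc N ^ j ≤ 8 * N ^ j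
suc-^≤8*^ j N j≤N with parity j
... | even h = ℕP.≤-trans (suc-^≤4*^-even h N j≤N) (ℕP.*-monoˡ-≤ (N ^ (h + h)) (ℕP.m≤m+n 4 4))
... | odd h  = begin
  suc N * suc N ^ (h + h)       ≤⟨ ℕP.*-mono-≤ 1+N≤2N (suc-^≤4*^-even h N (ℕP.<⇒≤ j≤N)) ⟩
  (2 * N) * (4 * N ^ (h + h))   ≡⟨ *-interchange 2 N 4 (N ^ (h + h)) ⟩
  8 * (N * N ^ (h + h))         ∎
  where
  open ℕP.≤-Reasoning
  1+N≤2N : suc N ≤ 2 * N
  1+N≤2N = ℕP.≤-trans (ℕP.+-monoˡ-≤ N (ℕP.≤-trans (s≤s z≤n) j≤N))
                      (ℕP.≤-reflexive (cong (_+_ N) (sym (ℕP.+-identityʳ N))))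

^*!≤8^*! : ∀ x j {y} → x + j ≡ y → y ^ j * x ! ≤ 8 ^ j * y !
^*!≤8^*! x j refl = go j
  where
  open ℕP.≤-Reasoning
  go : ∀ j → (x + j) ^ j * x ! ≤ 8 ^ j * (x + j) !
  go zero    rewrite ℕP.+-identityʳ x = ℕP.≤-refl
  go (suc j) rewrite ℕP.+-suc x j = begin
    suc (x + j) * suc (x + j) ^ j * x !      ≡⟨ ℕP.*-assoc (suc (x + j)) (suc (x + j) ^ j) (x !) ⟩
    suc (x + j) * (suc (x + j) ^ j * x !)    ≤⟨ ℕP.*-monoʳ-≤ (suc (x + j)) (ℕP.*-monoˡ-≤ (x !) sucPow≤) ⟩
    suc (x + j) * (8 * (x + j) ^ j * x !)    ≡⟨ cong (suc (x + j) *_) (ℕP.*-assoc 8 ((x + j) ^ j) (x !)) ⟩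
    suc (x + j) * (8 * ((x + j) ^ j * x !))  ≤⟨ ℕP.*-monoʳ-≤ (suc (x + j)) (ℕP.*-monoʳ-≤ 8 (go j)) ⟩
    suc (x + j) * (8 * (8 ^ j * (x + j) !))  ≡⟨ x∙yz≈y∙xz (suc (x + j)) 8 (8 ^ j * (x + j) !) ⟩
    8 * (suc (x + j) * (8 ^ j * (x + j) !))  ≡⟨ cong (8 *_) (x∙yz≈y∙xz (suc (x + j)) (8 ^ j) ((x + j) !)) ⟩
    8 * (8 ^ j * (suc (x + j) * (x + j) !))  ≡⟨ sym (ℕP.*-assoc 8 (8 ^ j) (suc (x + j) * (x + j) !)) ⟩
    8 * 8 ^ j * (suc (x + j) * (x + j) !)    ∎
    where
    sucPow≤ : suc (x + j) ^ j ≤ 8 * (x + j) ^ j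
    sucPow≤ = suc-^≤8*^ j (x + j) (ℕP.m≤n+m j x)

!≤^*! : ∀ x j {y} → x + j ≡ y → y ! ≤ y ^ j * x !
!≤^*! x j refl = go j
  where
  open ℕP.≤-Reasoning
  go : ∀ j → (x + j) ! ≤ (x + j) ^ j * x !
  go zero    rewrite ℕP.+-identityʳ x = ℕP.m≤m+n (x !) 0
  go (suc j) rewrite ℕP.+-suc x j = begin
    suc (x + j) * (x + j) !                ≤⟨ ℕP.*-monoʳ-≤ (suc (x + j)) (go j) ⟩
    suc (x + j) * ((x + j) ^ j * x !)      ≤⟨ ℕP.*-monoʳ-≤ (suc (x + j)) (ℕP.*-monoˡ-≤ (x !) pow≤) ⟩
    suc (x + j) * (suc (x + j) ^ j * x !)  ≡⟨ sym (ℕP.*-assoc (suc (x + j)) (suc (x + j) ^ j) (x !)) ⟩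
    suc (x + j) * suc (x + j) ^ j * x !    ∎
    where
    pow≤ : (x + j) ^ j ≤ suc (x + j) ^ j
    pow≤ = ℕP.^-monoˡ-≤ j (ℕP.n≤1+n (x + j))

C*!*!≡! : ∀ k l {n} → k + l ≡ n → (n C k) * (k ! * l !) ≡ n !
C*!*!≡! k l refl = begin
  ((k + l) C k) * (k ! * l !)               ≡⟨ cong (λ i → ((k + l) C k) * (k ! * i !)) (sym (ℕP.m+n∸m≡n k l)) ⟩
  ((k + l) C k) * (k ! * (k + l ∸ k) !)     ≡⟨ cong (_* (k ! * (k + l ∸ k) !)) (nCk≡n!/k![n-k]! k≤k+l) ⟩
  _                                         ≡⟨ m/n*n≡m {{k !* (k + l ∸ k) !≢0}} (k![n∸k]!∣n! k≤k+l) ⟩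
  (k + l) !                                 ∎
  where
  open ≡-Reasoning
  k≤k+l = ℕP.m≤m+n k l

-- Used with C₁ = C(N, M) = N!/(M! Z!), C₂ = C(a + b, a) = (a + b)!/(a! b!), p = Mᵏ, z = Zᵏ, ν = Nᵏ, e = 8ᵏ,
-- q = p⁷ and w = ν⁶ (so that p q = p⁸ and ν (ν w) = ν⁸); the proof multiplies through by M! Z! a! b! p z.
binomial-ratio-arith : ∀ p q ν w z e F G A B Mf Zf C₁ C₂ .{{_ : NonZero p}} .{{_ : NonZero z}}
                       .{{_ : NonZero (Mf * Zf)}} .{{_ : NonZero (A * B)}} →
                       C₁ * (Mf * Zf) ≡ F → C₂ * (A * B) ≡ G → F ≤ ν * ν * G →
                       p * A ≤ e * Mf → z * B ≤ e * Zf → e * e * q ≤ w * z →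
                       p * q * C₁ ≤ ν * (ν * w) * C₂
binomial-ratio-arith p q ν w z e F G A B Mf Zf C₁ C₂ C₁≡F C₂≡G F≤ pA≤ zB≤ eeq≤wz =
  ℕP.*-cancelʳ-≤ (p * q * C₁) (ν * (ν * w) * C₂) (Mf * Zf * (A * B) * (p * z))
                 {{ℕP.m*n≢0 (Mf * Zf * (A * B)) (p * z) {{ℕP.m*n≢0 (Mf * Zf) (A * B)}} {{ℕP.m*n≢0 p z}}}} (begin
    p * q * C₁ * (Mf * Zf * (A * B) * (p * z))         ≡⟨ regroup₁ p q z A B Mf Zf C₁ ⟩
    p * q * (C₁ * (Mf * Zf)) * ((p * A) * (z * B))     ≡⟨ cong (λ x → p * q * x * ((p * A) * (z * B))) C₁≡F ⟩
    p * q * F * ((p * A) * (z * B))                    ≤⟨ ℕP.*-mono-≤ (ℕP.*-monoʳ-≤ (p * q) F≤) (ℕP.*-mono-≤ pA≤ zB≤) ⟩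
    p * q * (ν * ν * G) * ((e * Mf) * (e * Zf))        ≡⟨ regroup₂ p q ν e G Mf Zf ⟩
    (e * e * q) * (p * (ν * ν) * G * (Mf * Zf))        ≤⟨ ℕP.*-monoˡ-≤ (p * (ν * ν) * G * (Mf * Zf)) eeq≤wz ⟩
    (w * z) * (p * (ν * ν) * G * (Mf * Zf))            ≡⟨ regroup₃ p ν w z G Mf Zf ⟩
    ν * (ν * w) * G * (Mf * Zf) * (p * z)              ≡⟨ cong (λ x → ν * (ν * w) * x * (Mf * Zf) * (p * z)) (sym C₂≡G) ⟩
    ν * (ν * w) * (C₂ * (A * B)) * (Mf * Zf) * (p * z) ≡⟨ regroup₄ p ν w z A B Mf Zf C₂ ⟩
    ν * (ν * w) * C₂ * (Mf * Zf * (A * B) * (p * z))   ∎)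
  where
  open ℕP.≤-Reasoning
  regroup₁ : ∀ p q z A B Mf Zf C₁ →
             p * q * C₁ * (Mf * Zf * (A * B) * (p * z)) ≡ p * q * (C₁ * (Mf * Zf)) * ((p * A) * (z * B))
  regroup₁ = solve-∀
  regroup₂ : ∀ p q ν e G Mf Zf →
             p * q * (ν * ν * G) * ((e * Mf) * (e * Zf)) ≡ (e * e * q) * (p * (ν * ν) * G * (Mf * Zf))
  regroup₂ = solve-∀
  regroup₃ : ∀ p ν w z G Mf Zf → (w * z) * (p * (ν * ν) * G * (Mf * Zf)) ≡ ν * (ν * w) * G * (Mf * Zf) * (p * z)
  regroup₃ = solve-∀
  regroup₄ : ∀ p ν w z A B Mf Zf C₂ →
             ν * (ν * w) * (C₂ * (A * B)) * (Mf * Zf) * (p * z) ≡ ν * (ν * w) * C₂ * (Mf * Zf * (A * B) * (p * z))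
  regroup₄ = solve-∀

regroup-sum : ∀ k a b {M Z N} → a + k ≡ M → b + k ≡ Z → M + Z ≡ N → (b + a) + (k + k) ≡ N
regroup-sum k a b {M} {Z} {N} a+k≡M b+k≡Z M+Z≡N = begin
  (b + a) + (k + k)  ≡⟨ shuffle a b k ⟩
  (a + k) + (b + k)  ≡⟨ cong₂ _+_ a+k≡M b+k≡Z ⟩
  M + Z              ≡⟨ M+Z≡N ⟩
  N                  ∎
  where
  open ≡-Reasoning
  shuffle : ∀ a b k → (b + a) + (k + k) ≡ (a + k) + (b + k)
  shuffle = solve-∀

binomial-ratio : ∀ k a b {M Z N} → a + k ≡ M → b + k ≡ Z → M + Z ≡ N → a ≤ b → .{{_ : NonZero M}} →
                 M ^ (8 * k) * (N C M) ≤ N ^ (8 * k) * ((b + a) C a)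
binomial-ratio k a b {M} {Z} {N} a+k≡M b+k≡Z M+Z≡N a≤b =
  subst₂ (λ u v → u * (N C M) ≤ v * ((b + a) C a)) (^8 M) (^8 N)
    (binomial-ratio-arith (M ^ k) ((M ^ k) ^ 7) (N ^ k) ((N ^ k) ^ 6) (Z ^ k) (8 ^ k)
                          (N !) ((b + a) !) (a !) (b !) (M !) (Z !) (N C M) ((b + a) C a)
                          {{ℕP.m^n≢0 M k}} {{ℕP.m^n≢0 Z k {{Z≢0}}}} {{M !* Z !≢0}} {{a !* b !≢0}}
                          (C*!*!≡! M Z M+Z≡N) (C*!*!≡! a b (ℕP.+-comm a b)) N!≤
                          (^*!≤8^*! a k a+k≡M) (^*!≤8^*! b k b+k≡Z) powers)
  where
  open ℕP.≤-Reasoning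
  ^8 : ∀ x → (x ^ k) ^ 8 ≡ x ^ (8 * k)
  ^8 x = trans (ℕP.^-*-assoc x k 8) (cong (x ^_) (ℕP.*-comm k 8))
  M≤Z : M ≤ Z
  M≤Z = subst₂ _≤_ a+k≡M b+k≡Z (ℕP.+-monoˡ-≤ k a≤b)
  Z≢0 : NonZero Z
  Z≢0 = ℕ.>-nonZero (ℕP.≤-trans (ℕ.>-nonZero⁻¹ M) M≤Z)
  N!≤ : N ! ≤ N ^ k * N ^ k * (b + a) !
  N!≤ = subst (λ u → N ! ≤ u * (b + a) !) (ℕP.^-distribˡ-+-* N k k)
              (!≤^*! (b + a) (k + k) (regroup-sum k a b a+k≡M b+k≡Z M+Z≡N))
  2M≤N : 2 * M ≤ N
  2M≤N = begin
    M + (M + 0)  ≡⟨ cong (_+_ M) (ℕP.+-identityʳ M) ⟩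
    M + M        ≤⟨ ℕP.+-monoʳ-≤ M M≤Z ⟩
    M + Z        ≡⟨ M+Z≡N ⟩
    N            ∎
  64M⁷≤N⁶Z : 64 * M ^ 7 ≤ N ^ 6 * Z
  64M⁷≤N⁶Z = begin
    64 * M ^ 7          ≡⟨ cong (64 *_) (ℕP.*-comm M (M ^ 6)) ⟩
    64 * (M ^ 6 * M)    ≡⟨ sym (ℕP.*-assoc 64 (M ^ 6) M) ⟩
    64 * M ^ 6 * M      ≡⟨ cong (_* M) (sym (^-distribʳ-* 2 M 6)) ⟩
    (2 * M) ^ 6 * M     ≤⟨ ℕP.*-mono-≤ (ℕP.^-monoˡ-≤ 6 2M≤N) M≤Z ⟩
    N ^ 6 * Z           ∎
  powers : 8 ^ k * 8 ^ k * (M ^ k) ^ 7 ≤ (N ^ k) ^ 6 * Z ^ k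
  powers = begin
    8 ^ k * 8 ^ k * (M ^ k) ^ 7  ≡⟨ cong₂ _*_ (sym (^-distribʳ-* 8 8 k)) (^-comm M k 7) ⟩
    64 ^ k * (M ^ 7) ^ k         ≡⟨ sym (^-distribʳ-* 64 (M ^ 7) k) ⟩
    (64 * M ^ 7) ^ k             ≤⟨ ℕP.^-monoˡ-≤ k 64M⁷≤N⁶Z ⟩
    (N ^ 6 * Z) ^ k              ≡⟨ ^-distribʳ-* (N ^ 6) Z k ⟩
    (N ^ 6) ^ k * Z ^ k          ≡⟨ cong (_* Z ^ k) (^-comm N 6 k) ⟩
    (N ^ k) ^ 6 * Z ^ k          ∎

binomial-bound-≤ : ∀ n m k → 0 < m → 2 * m ≤ n → k ≤ m → m ^ (8 * k) * (n C m) ≤ n ^ (8 * k) * sliceBound n m k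
binomial-bound-≤ n m k 0<m 2m≤n k≤m =
  subst (λ t → m ^ (8 * k) * (n C m) ≤ n ^ (8 * k) * (t C a)) (sym n∸k∸k≡b+a)
        (binomial-ratio k a b a+k≡m b+k≡n∸m m+[n∸m]≡n a≤b {{ℕ.>-nonZero 0<m}})
  where
  a = m ∸ k
  b = n ∸ m ∸ k
  m≤n∸m : m ≤ n ∸ m
  m≤n∸m = ℕP.m+n≤o⇒m≤o∸n m (subst (_≤ n) (cong (_+_ m) (ℕP.+-identityʳ m)) 2m≤n)
  a+k≡m = ℕP.m∸n+n≡m k≤m
  b+k≡n∸m = ℕP.m∸n+n≡m (ℕP.≤-trans k≤m m≤n∸m)
  m+[n∸m]≡n = ℕP.m+[n∸m]≡n (ℕP.≤-trans (ℕP.m≤m+n m (m + 0)) 2m≤n)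
  a≤b = ℕP.∸-monoˡ-≤ k m≤n∸m
  n∸k∸k≡b+a : n ∸ k ∸ k ≡ b + a
  n∸k∸k≡b+a = begin
    n ∸ k ∸ k                    ≡⟨ ℕP.∸-+-assoc n k k ⟩
    n ∸ (k + k)                  ≡⟨ cong (_∸ (k + k)) (sym (regroup-sum k a b a+k≡m b+k≡n∸m m+[n∸m]≡n)) ⟩
    (b + a) + (k + k) ∸ (k + k)  ≡⟨ ℕP.m+n∸n≡m (b + a) (k + k) ⟩
    b + a                        ∎
    where open ≡-Reasoning

raise-exponent : ∀ {m n i j} X Y → m ≤ n → i ≤ j → m ^ i * X ≤ n ^ i * Y → m ^ j * X ≤ n ^ j * Y
raise-exponent {m} {n} {i} X Y m≤n i≤j mⁱX≤nⁱY with ℕP.m≤n⇒∃[o]m+o≡n i≤j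
... | r , refl = begin
  m ^ (i + r) * X      ≡⟨ cong (_* X) (ℕP.^-distribˡ-+-* m i r) ⟩
  m ^ i * m ^ r * X    ≡⟨ xy∙z≈y∙xz (m ^ i) (m ^ r) X ⟩
  m ^ r * (m ^ i * X)  ≤⟨ ℕP.*-mono-≤ (ℕP.^-monoˡ-≤ r m≤n) mⁱX≤nⁱY ⟩
  n ^ r * (n ^ i * Y)  ≡⟨ sym (xy∙z≈y∙xz (n ^ i) (n ^ r) Y) ⟩
  n ^ i * n ^ r * Y    ≡⟨ cong (_* Y) (sym (ℕP.^-distribˡ-+-* n i r)) ⟩
  n ^ (i + r) * Y      ∎
  where open ℕP.≤-Reasoning

binomial-bound : ∀ n m k → 0 < m → 2 * m ≤ n → m ^ (8 * k) * (n C m) ≤ n ^ (8 * k) * sliceBound n m k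
binomial-bound n m k 0<m 2m≤n with k ℕ.≤? m
... | yes k≤m = binomial-bound-≤ n m k 0<m 2m≤n k≤m
... | no  k≰m = raise-exponent (n C m) (sliceBound n m k) m≤n (ℕP.*-monoʳ-≤ 8 m≤k)
                  (subst (λ c → m ^ (8 * m) * (n C m) ≤ n ^ (8 * m) * c)
                         (trans (m≤k⇒sliceBound≡1 n m m ℕP.≤-refl) (sym (m≤k⇒sliceBound≡1 n m k m≤k)))
                         (binomial-bound-≤ n m m 0<m 2m≤n ℕP.≤-refl))
  where
  m≤k = ℕP.<⇒≤ (ℕP.≰⇒> k≰m)
  m≤n = ℕP.≤-trans (ℕP.m≤m+n m (m + 0)) 2m≤n

-- ℚᵘ does not normalise, so the power is literally mᵉ over (1 + n)ᵉ; mkℚᵘ stores the denominator minus one.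
toℚᵘ-^ : ∀ m n e → toℚᵘ (((+ m) / suc n) ^ℚ e) ℚᵘ.≃ mkℚᵘ (+ (m ^ e)) (pred (suc n ^ e))
toℚᵘ-^ m n zero    = *≡* refl
toℚᵘ-^ m n (suc e) = begin
  toℚᵘ (p ℚ.* p ^ℚ e)
    ≈⟨ ℚP.toℚᵘ-homo-* p (p ^ℚ e) ⟩
  toℚᵘ p ℚᵘ.* toℚᵘ (p ^ℚ e)
    ≈⟨ ℚᵘP.*-cong (ℚP.toℚᵘ-fromℚᵘ (mkℚᵘ (+ m) n)) (toℚᵘ-^ m n e) ⟩
  mkℚᵘ (+ m) n ℚᵘ.* mkℚᵘ (+ (m ^ e)) (pred (suc n ^ e))
    ≡⟨ cong₂ mkℚᵘ (sym (ℤP.pos-* m (m ^ e)))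
                  (cong (λ d → pred (suc n * d)) (ℕP.suc-pred (suc n ^ e) {{ℕP.m^n≢0 (suc n) e}})) ⟩
  mkℚᵘ (+ (m ^ suc e)) (pred (suc n ^ suc e)) ∎
  where
  open ℚᵘP.≃-Reasoning
  p = (+ m) / suc n

cross-multiplied⇒^ℚ*≤ : ∀ n m e B N .{{_ : NonZero n}} → m ^ e * B ≤ n ^ e * N →
       ((+ m) / n) ^ℚ e ℚ.* ℤ→ℚ (+ B) ℚ.≤ ℤ→ℚ (+ N)
cross-multiplied⇒^ℚ*≤ (suc n) m e B N mᵉB≤nᵉN = ℚP.toℚᵘ-cancel-≤ (begin
  toℚᵘ (((+ m) / suc n) ^ℚ e ℚ.* ℤ→ℚ (+ B))               ≃⟨ ℚP.toℚᵘ-homo-* (((+ m) / suc n) ^ℚ e) (ℤ→ℚ (+ B)) ⟩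
  toℚᵘ (((+ m) / suc n) ^ℚ e) ℚᵘ.* toℚᵘ (ℤ→ℚ (+ B))       ≃⟨ ℚᵘP.*-cong (toℚᵘ-^ m n e) (ℚP.toℚᵘ-fromℚᵘ (mkℚᵘ (+ B) 0)) ⟩
  mkℚᵘ (+ (m ^ e)) (pred (suc n ^ e)) ℚᵘ.* mkℚᵘ (+ B) 0   ≤⟨ *≤* (subst₂ ℤ._≤_ lhs rhs (ℤ.+≤+ cross)) ⟩
  mkℚᵘ (+ N) 0                                             ≃⟨ ℚᵘP.≃-sym (ℚP.toℚᵘ-fromℚᵘ (mkℚᵘ (+ N) 0)) ⟩
  toℚᵘ (ℤ→ℚ (+ N))                                         ∎)
  where
  open ℚᵘP.≤-Reasoning
  den = pred (suc n ^ e)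
  cross : m ^ e * B * 1 ≤ N * suc (den * 1)
  cross = subst₂ _≤_ (sym (ℕP.*-identityʳ (m ^ e * B)))
                     (trans (ℕP.*-comm (suc n ^ e) N)
                            (cong (N *_) (trans (sym (ℕP.suc-pred (suc n ^ e) {{ℕP.m^n≢0 (suc n) e}}))
                                                (cong suc (sym (ℕP.*-identityʳ den))))))
                     mᵉB≤nᵉN
  lhs : + (m ^ e * B * 1) ≡ (+ (m ^ e) ℤ.* + B) ℤ.* + 1
  lhs = trans (ℤP.pos-* (m ^ e * B) 1) (cong (ℤ._* + 1) (ℤP.pos-* (m ^ e) B))
  rhs : + (N * suc (den * 1)) ≡ + N ℤ.* + suc (den * 1)
  rhs = ℤP.pos-* N (suc (den * 1))

nonzeroCount-density : ∀ n m k (f : Vec Bool n → ℤ) → 0 < m → 2 * m ≤ n → DegreeAtMost n m k f →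
                       0 < nonzeroCount n m f → m ^ (8 * k) * length (slice n m) ≤ n ^ (8 * k) * nonzeroCount n m f
nonzeroCount-density n m k f 0<m 2m≤n degree≤k 0<count = begin
  m ^ (8 * k) * length (slice n m)  ≡⟨ cong (m ^ (8 * k) *_) (length-slice n m) ⟩
  m ^ (8 * k) * (n C m)             ≤⟨ binomial-bound n m k 0<m 2m≤n ⟩
  n ^ (8 * k) * sliceBound n m k    ≤⟨ ℕP.*-monoʳ-≤ (n ^ (8 * k)) count-bound ⟩
  n ^ (8 * k) * nonzeroCount n m f  ∎
  where
  open ℕP.≤-Reasoning
  count-bound = nonzeroCount-bound n m k f (degree⇒differencesVanish f degree≤k) 0<count

lemma5p2 : Σ ℕ λ C →
    (n m k : ℕ) → .{{_ : NonZero n}} → 0 < m → 2 * m ≤ n →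
    (f : Vec Bool n → ℤ) → DegreeAtMost n m k f →
    VanishesOnSlice n m f ⊎ ProbNonzeroAtLeast n m f (((+ m) / n) ^ℚ (C * k))
lemma5p2 = 8 , λ n m k 0<m 2m≤n f degree≤k → case nonzeroCount n m f ℕ.≟ 0 of λ where
  (yes count≡0) → inj₁ (nonzeroCount≡0⇒vanishes n m f count≡0)
  (no  count≢0) → inj₂ (cross-multiplied⇒^ℚ*≤ n m (8 * k) _ _
                          (nonzeroCount-density n m k f 0<m 2m≤n degree≤k (ℕP.n≢0⇒n>0 count≢0)))
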